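{- Let $k\ge 2$ and $n\ge 0$, and let $p$ be either $1$ or a prime. Then $\Delta^{k-1}a_{p,k}(n)=m_n(p)$, where $\Delta$ is the forward difference operator $\Delta s(n)=s(n+1)-s(n)$.
   Context: A partition of $n$ is a weakly decreasing finite sequence of positive integers summing to $n$; $\mathcal P(n)$ is the set of partitions of $n$ (the empty partition being the unique partition of $0$). For a partition $\lambda$ and positive integer $i$, $m_\lambda(i)$ is the number of parts equal to $i$, and $m_n(i)=\sum_{\lambda\in\mathcal P(n)} m_\lambda(i)$. For $\lambda=(\lambda_1,\ldots,\lambda_\ell)$ with $\ell\ge k$, $\mathrm{pre}_k(\lambda)$ is the partition whose parts are the $\binom{\ell}{k}$ products $\lambda_{i_1}\cdots\lambda_{i_k}$ over all $1\le i_1<\cdots<i_k\le\ell$ (with multiplicity); it is undefined if $\ell<k$. $\mathrm{pre}_k(\mathcal P(n))$ is the set of $\mathrm{pre}_k(\lambda)$ for $\lambda\in\mathcal P(n)$ with at least $k$ parts, and $a_{i,k}(n)=\sum_{\nu\in\mathrm{pre}_k(\mathcal P(n))} m_\nu(i)$. -}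

module Defs where

open import Data.Nat using (ℕ; zero; suc; _*_; _≥_; _∸_)
open import Data.Nat.Properties using (_≟_)
open import Data.Integer as ℤ using (ℤ; +_)
open import Data.List using (List; []; _∷_; map; length; filter; _++_)
open import Data.Nat.ListAction using (sum; product)
open import Relation.Nullary using (yes; no)
open import Data.List.Relation.Unary.All using (All)
open import Data.List.Relation.Unary.Linked using (Linked)
open import Data.Nat using (_≤_; NonZero)
open import Data.Product using (_×_)
open import Relation.Binary.PropositionalEquality using (_≡_)
open import Data.Nat using (_<_)

IsPartition : ℕ → List ℕ → Set
IsPartition n λs = Linked _≥_ λs × All (λ x → 1 ≤ x) λs × sum λs ≡ n

mult : List ℕ → ℕ → ℕ
mult [] i = 0
mult (x ∷ xs) i with x ≟ i
... | yes _ = suc (mult xs i)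
... | no  _ = mult xs i

choose : ℕ → List ℕ → List (List ℕ)
choose zero    _        = [] ∷ []
choose (suc k) []       = []
choose (suc k) (x ∷ xs) = map (x ∷_) (choose k xs) ++ choose (suc k) xs

-- pre_k(λ) as a multiset of parts: the products over all k-subsets of positions.
-- (The paper sorts these into a partition; sortedness is irrelevant for multiplicities.)
pre : ℕ → List ℕ → List ℕ
pre k λs = map product (choose k λs)

-- m_n(i) = Σ_{λ ∈ P(n)} m_λ(i), given an enumeration P n of P(n)
mTotal : (ℕ → List (List ℕ)) → ℕ → ℕ → ℕ
mTotal P n i = sum (map (λ λs → mult λs i) (P n))

aik : (ℕ → List (List ℕ)) → ℕ → ℕ → ℕ → ℕ
aik P i k n = sum (map (λ λs → mult (pre k λs) i) (filter (λ λs → k Data.Nat.≤? length λs) (P n)))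

Δ : (ℕ → ℤ) → (ℕ → ℤ)
Δ s n = s (suc n) ℤ.- s n

Δ^ : ℕ → (ℕ → ℤ) → (ℕ → ℤ)
Δ^ zero    s = s
Δ^ (suc j) s = Δ (Δ^ j s)

{-# OPTIONS --safe #-}
-- A product of parts of λ is 1 only if all its factors are 1, and is a prime p only if one
-- factor is p and the others are 1. Hence, with a = m_λ(1), exactly C(a, k) of the k-subsets
-- of parts have product 1 and m_λ(p)·C(a, k−1) have product p, so a_{1,k} = S_k and
-- a_{p,k} = S_{k−1} for the sums S_r(n) = Σ_{λ ⊢ n} w(λ)·C(m_λ(1), r) with weight w(λ) = 1,
-- resp. w(λ) = m_λ(p); neither weight changes when a part 1 is added. Deleting a part 1 maps
-- the partitions of n+1 containing 1 bijectively onto the partitions of n, so Pascal's rule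
-- gives S_{r+1}(n+1) = S_{r+1}(n) + S_r(n), i.e. ΔS_{r+1} = S_r, and Δ^{k−1} leaves
-- S_1 = m_n(1), resp. S_0 = m_n(p).

module Submission where

open import Defs
open import Data.Nat using (ℕ; zero; suc; _+_; _*_; _≤_; _≥_; _<_; _∸_; z≤n; s≤s; _≤?_; NonZero)
open import Data.Nat.Properties
  using (_≟_; +-comm; +-suc; +-identityʳ; *-zeroʳ; *-identityˡ; *-identityʳ; *-comm; *-distribˡ-+;
         *-cancelˡ-≡; m*n≡1⇒m≡1; ≤-antisym; suc-injective; m<n⇒m<1+n; ≰⇒>; +-commutativeSemigroup)
open import Data.Nat.Combinatorics using (_C_; nC1≡n; nCk+nC[k+1]≡[n+1]C[k+1])
open import Data.Nat.Divisibility using (divides)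
open import Data.Nat.Primality using (Prime; ¬prime[1]; prime⇒irreducible; prime⇒nonZero)
open import Data.Nat.ListAction using (sum; product)
open import Data.Nat.ListAction.Properties using (sum-++; sum-↭)
open import Data.Integer as ℤ using (ℤ; +_)
open import Data.Integer.Properties using (pos-+; +-0-abelianGroup)
open import Algebra.Properties.AbelianGroup +-0-abelianGroup using (xyx⁻¹≈y)
open import Algebra.Properties.CommutativeSemigroup +-commutativeSemigroup using (interchange)
open import Data.List using (List; []; _∷_; [_]; map; length; filter; _++_; _∷ʳ_)
open import Data.List.Properties using (map-cong; map-id; map-∘; map-++; ∷ʳ-injectiveˡ)
open import Data.List.Membership.Propositional using (_∈_; _∉_)
open import Data.List.Membership.Propositional.Properties
  using (∈-map⁺; ∈-map⁻; ∈-filter⁺; ∈-filter⁻; ∈-++⁺ʳ)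
open import Data.List.Membership.Propositional.Properties.WithK using (unique∧set⇒bag)
open import Data.List.Membership.DecPropositional _≟_ using (_∈?_)
open import Data.List.Relation.Unary.Any using (here; there)
open import Data.List.Relation.Unary.All using (All; []; _∷_)
open import Data.List.Relation.Unary.All.Properties using (++⁻ˡ; ++⁺)
open import Data.List.Relation.Unary.Linked using (Linked; []; [-]; _∷_)
open import Data.List.Relation.Unary.Unique.Propositional using (Unique)
import Data.List.Relation.Unary.Unique.Propositional.Properties as Unique
open import Data.List.Relation.Binary.Permutation.Propositional using (_↭_)
import Data.List.Relation.Binary.Permutation.Propositional.Properties as ↭
open import Data.List.Relation.Binary.BagAndSetEquality using (∼bag⇒↭)
open import Data.Product using (_,_; ∃-syntax)
open import Data.Sum using (_⊎_; inj₁; inj₂)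
open import Function using (_∘_; const)
open import Function.Bundles using (_⇔_; mk⇔; Equivalence)
open import Level using (Level)
open import Relation.Binary.Core using (Rel)
open import Relation.Nullary using (¬_; yes; no; contradiction)
open import Relation.Unary using (Pred; Decidable)
open import Relation.Binary.PropositionalEquality
  using (_≡_; _≢_; refl; sym; trans; cong; cong₂; module ≡-Reasoning)

open ≡-Reasoning

private
  variable
    a r : Level
    A : Set a

sum-map-+ : ∀ (f g : A → ℕ) xs → sum (map (λ x → f x + g x) xs) ≡ sum (map f xs) + sum (map g xs)
sum-map-+ f g []       = refl
sum-map-+ f g (x ∷ xs) = trans (cong (_+_ (f x + g x)) (sum-map-+ f g xs)) (interchange (f x) (g x) _ _)

sum-map-filter : ∀ {P : Pred A r} (P? : Decidable P) (f : A → ℕ) → (∀ x → ¬ P x → f x ≡ 0) →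
                 ∀ xs → sum (map f (filter P? xs)) ≡ sum (map f xs)
sum-map-filter P? f f≡0 []       = refl
sum-map-filter P? f f≡0 (x ∷ xs) with P? x
... | yes _  = cong (_+_ (f x)) (sum-map-filter P? f f≡0 xs)
... | no ¬Px = trans (sum-map-filter P? f f≡0 xs) (cong (_+ sum (map f xs)) (sym (f≡0 x ¬Px)))

Linked-∷ʳ : ∀ {R : Rel A r} {xs y} → Linked R xs → All (λ x → R x y) xs → Linked R (xs ∷ʳ y)
Linked-∷ʳ []        []            = [-]
Linked-∷ʳ [-]       (Rxy ∷ [])    = Rxy ∷ [-]
Linked-∷ʳ (Rxy ∷ l) (_ ∷ Rys)     = Rxy ∷ Linked-∷ʳ l Rys

Linked-++⁻ˡ : ∀ {R : Rel A r} xs {ys} → Linked R (xs ++ ys) → Linked R xs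
Linked-++⁻ˡ []           _         = []
Linked-++⁻ˡ (x ∷ [])     _         = [-]
Linked-++⁻ˡ (x ∷ y ∷ xs) (Rxy ∷ l) = Rxy ∷ Linked-++⁻ˡ (y ∷ xs) l

∷ʳ-of-lowerBound-∈ : ∀ {m xs} → Linked _≥_ xs → All (m ≤_) xs → m ∈ xs → ∃[ ys ] xs ≡ ys ∷ʳ m
∷ʳ-of-lowerBound-∈ [-] _ (here refl) = [] , refl
∷ʳ-of-lowerBound-∈ {m} {x ∷ y ∷ _} (x≥y ∷ l) (_ ∷ m≤ys@(m≤y ∷ _)) m∈
  with ∷ʳ-of-lowerBound-∈ l m≤ys (tail∋m m∈)
  where
  tail∋m : m ∈ x ∷ y ∷ _ → m ∈ y ∷ _
  tail∋m (here refl) = here (≤-antisym m≤y x≥y)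
  tail∋m (there m∈)  = m∈
... | ys , y∷zs≡ys∷ʳm = x ∷ ys , cong (x ∷_) y∷zs≡ys∷ʳm

Δ-cong : ∀ {s t} → (∀ m → s m ≡ t m) → ∀ n → Δ s n ≡ Δ t n
Δ-cong s≡t n = cong₂ ℤ._-_ (s≡t (suc n)) (s≡t n)

Δ^-cong : ∀ j {s t} → (∀ m → s m ≡ t m) → ∀ n → Δ^ j s n ≡ Δ^ j t n
Δ^-cong zero    s≡t = s≡t
Δ^-cong (suc j) s≡t = Δ-cong (Δ^-cong j s≡t)

Δ^-telescope : ∀ (s : ℕ → ℕ → ℤ) → (∀ r n → Δ (s (suc r)) n ≡ s r n) →
               ∀ j r n → Δ^ j (s (r + j)) n ≡ s r n
Δ^-telescope s Δs zero    r n = cong (λ i → s i n) (+-identityʳ r)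
Δ^-telescope s Δs (suc j) r n = begin
  Δ (Δ^ j (s (r + suc j))) n  ≡⟨ cong (λ i → Δ (Δ^ j (s i)) n) (+-suc r j) ⟩
  Δ (Δ^ j (s (suc r + j))) n  ≡⟨ Δ-cong (Δ^-telescope s Δs j (suc r)) n ⟩
  Δ (s (suc r)) n             ≡⟨ Δs r n ⟩
  s r n                       ∎

mult-++ : ∀ xs ys i → mult (xs ++ ys) i ≡ mult xs i + mult ys i
mult-++ []       ys i = refl
mult-++ (x ∷ xs) ys i with x ≟ i
... | yes _ = cong suc (mult-++ xs ys i)
... | no _  = mult-++ xs ys i

mult-∉ : ∀ {i xs} → i ∉ xs → mult xs i ≡ 0
mult-∉ {xs = []}     _  = refl
mult-∉ {i} {x ∷ xs} i∉ with x ≟ i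
... | yes refl = contradiction (here refl) i∉
... | no _     = mult-∉ (i∉ ∘ there)

mult-map : ∀ (f : ℕ → ℕ) {p q} → f q ≡ p → (∀ y → f y ≡ p → y ≡ q) →
           ∀ ys → mult (map f ys) p ≡ mult ys q
mult-map f fq≡p fy≡p⇒y≡q []       = refl
mult-map f {p} {q} fq≡p fy≡p⇒y≡q (y ∷ ys) with f y ≟ p | y ≟ q
... | yes _    | yes _    = cong suc (mult-map f fq≡p fy≡p⇒y≡q ys)
... | yes fy≡p | no y≢q   = contradiction (fy≡p⇒y≡q y fy≡p) y≢q
... | no fy≢p  | yes refl = contradiction fq≡p fy≢p
... | no _     | no _     = mult-map f fq≡p fy≡p⇒y≡q ys

mult-map-∉ : ∀ (f : ℕ → ℕ) {p} → (∀ y → f y ≢ p) → ∀ ys → mult (map f ys) p ≡ 0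
mult-map-∉ f fy≢p ys = mult-∉ {xs = map f ys} λ p∈ →
  let y , _ , p≡fy = ∈-map⁻ f p∈ in fy≢p y (sym p≡fy)

mult-map-1* : ∀ ys i → mult (map (1 *_) ys) i ≡ mult ys i
mult-map-1* ys i = cong (λ zs → mult zs i) (trans (map-cong *-identityˡ ys) (map-id ys))

mult-map-*-1 : ∀ {x} → x ≢ 1 → ∀ ys → mult (map (x *_) ys) 1 ≡ 0
mult-map-*-1 {x} x≢1 = mult-map-∉ (x *_) (λ y → x≢1 ∘ m*n≡1⇒m≡1 x y)

mult-map-*-self : ∀ x .{{_ : NonZero x}} ys → mult (map (x *_) ys) x ≡ mult ys 1
mult-map-*-self x = mult-map (x *_) (*-identityʳ x) x*y≡x⇒y≡1
  where
  x*y≡x⇒y≡1 : ∀ y → x * y ≡ x → y ≡ 1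
  x*y≡x⇒y≡1 y x*y≡x = *-cancelˡ-≡ y 1 x (trans x*y≡x (sym (*-identityʳ x)))

mult-map-*-prime : ∀ {p x} → Prime p → x ≢ 1 → x ≢ p → ∀ ys → mult (map (x *_) ys) p ≡ 0
mult-map-*-prime {p} {x} p-prime x≢1 x≢p = mult-map-∉ (x *_) x*y≢p
  where
  x*y≢p : ∀ y → x * y ≢ p
  x*y≢p y x*y≡p with prime⇒irreducible p-prime (divides y (trans (sym x*y≡p) (*-comm x y)))
  ... | inj₁ x≡1 = x≢1 x≡1
  ... | inj₂ x≡p = x≢p x≡p

mult-∷ʳ-≢ : ∀ {x i} xs → x ≢ i → mult (xs ∷ʳ x) i ≡ mult xs i
mult-∷ʳ-≢ {x} {i} xs x≢i = begin
  mult (xs ∷ʳ x) i          ≡⟨ mult-++ xs [ x ] i ⟩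
  mult xs i + mult [ x ] i  ≡⟨ cong (_+_ (mult xs i)) (mult-∉ λ { (here i≡x) → x≢i (sym i≡x) }) ⟩
  mult xs i + 0             ≡⟨ +-identityʳ (mult xs i) ⟩
  mult xs i                 ∎

pre-∷ : ∀ k x xs → pre (suc k) (x ∷ xs) ≡ map (x *_) (pre k xs) ++ pre (suc k) xs
pre-∷ k x xs = begin
  map product (map (x ∷_) (choose k xs) ++ choose (suc k) xs)
    ≡⟨ map-++ product (map (x ∷_) (choose k xs)) (choose (suc k) xs) ⟩
  map product (map (x ∷_) (choose k xs)) ++ pre (suc k) xs
    ≡⟨ cong (_++ pre (suc k) xs) (trans (sym (map-∘ (choose k xs))) (map-∘ (choose k xs))) ⟩
  map (x *_) (pre k xs) ++ pre (suc k) xs ∎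

mult-pre-∷ : ∀ k x xs i → mult (pre (suc k) (x ∷ xs)) i ≡ mult (map (x *_) (pre k xs)) i + mult (pre (suc k) xs) i
mult-pre-∷ k x xs i = trans (cong (λ zs → mult zs i) (pre-∷ k x xs)) (mult-++ (map (x *_) (pre k xs)) _ i)

mult-pre-1 : ∀ k xs → mult (pre k xs) 1 ≡ mult xs 1 C k
mult-pre-1 zero    xs       = refl
mult-pre-1 (suc k) []       = refl
mult-pre-1 (suc k) (x ∷ xs) with x ≟ 1
... | yes refl = begin
  mult (pre (suc k) (1 ∷ xs)) 1                             ≡⟨ mult-pre-∷ k 1 xs 1 ⟩
  mult (map (1 *_) (pre k xs)) 1 + mult (pre (suc k) xs) 1  ≡⟨ cong₂ _+_ (trans (mult-map-1* (pre k xs) 1) (mult-pre-1 k xs))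
                                                                        (mult-pre-1 (suc k) xs) ⟩
  mult xs 1 C k + mult xs 1 C suc k                         ≡⟨ nCk+nC[k+1]≡[n+1]C[k+1] (mult xs 1) k ⟩
  suc (mult xs 1) C suc k                                   ∎
... | no x≢1 = begin
  mult (pre (suc k) (x ∷ xs)) 1                             ≡⟨ mult-pre-∷ k x xs 1 ⟩
  mult (map (x *_) (pre k xs)) 1 + mult (pre (suc k) xs) 1  ≡⟨ cong₂ _+_ (mult-map-*-1 x≢1 (pre k xs))
                                                                        (mult-pre-1 (suc k) xs) ⟩
  mult xs 1 C suc k                                         ∎

mult-pre-prime : ∀ {p} → Prime p → ∀ k xs → mult (pre (suc k) xs) p ≡ mult xs p * (mult xs 1 C k)
mult-pre-prime p-prime k [] = refl
mult-pre-prime {p} p-prime k (x ∷ xs) with x ≟ 1 | x ≟ p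
... | yes refl | yes refl = contradiction p-prime ¬prime[1]
... | yes refl | no 1≢p = begin
  mult (pre (suc k) (1 ∷ xs)) p                             ≡⟨ mult-pre-∷ k 1 xs p ⟩
  mult (map (1 *_) (pre k xs)) p + mult (pre (suc k) xs) p  ≡⟨ cong₂ _+_ (mult-map-1* (pre k xs) p)
                                                                        (mult-pre-prime p-prime k xs) ⟩
  mult (pre k xs) p + mult xs p * (mult xs 1 C k)           ≡⟨ pascal k ⟩
  mult xs p * (suc (mult xs 1) C k)                         ∎
  where
  pascal : ∀ k → mult (pre k xs) p + mult xs p * (mult xs 1 C k) ≡ mult xs p * (suc (mult xs 1) C k)
  pascal zero    = cong (_+ mult xs p * 1) (mult-∉ λ { (here p≡1) → 1≢p (sym p≡1) })
  pascal (suc k) = begin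
    mult (pre (suc k) xs) p + mult xs p * (mult xs 1 C suc k)
      ≡⟨ cong (_+ mult xs p * (mult xs 1 C suc k)) (mult-pre-prime p-prime k xs) ⟩
    mult xs p * (mult xs 1 C k) + mult xs p * (mult xs 1 C suc k)
      ≡⟨ *-distribˡ-+ (mult xs p) (mult xs 1 C k) (mult xs 1 C suc k) ⟨
    mult xs p * (mult xs 1 C k + mult xs 1 C suc k)
      ≡⟨ cong (mult xs p *_) (nCk+nC[k+1]≡[n+1]C[k+1] (mult xs 1) k) ⟩
    mult xs p * (suc (mult xs 1) C suc k) ∎
... | no _ | yes refl = begin
  mult (pre (suc k) (p ∷ xs)) p                             ≡⟨ mult-pre-∷ k p xs p ⟩
  mult (map (p *_) (pre k xs)) p + mult (pre (suc k) xs) p  ≡⟨ cong₂ _+_ (mult-map-*-self p {{prime⇒nonZero p-prime}} (pre k xs))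
                                                                        (mult-pre-prime p-prime k xs) ⟩
  mult (pre k xs) 1 + mult xs p * (mult xs 1 C k)           ≡⟨ cong (_+ mult xs p * (mult xs 1 C k)) (mult-pre-1 k xs) ⟩
  suc (mult xs p) * (mult xs 1 C k)                         ∎
... | no x≢1 | no x≢p = begin
  mult (pre (suc k) (x ∷ xs)) p                             ≡⟨ mult-pre-∷ k x xs p ⟩
  mult (map (x *_) (pre k xs)) p + mult (pre (suc k) xs) p  ≡⟨ cong₂ _+_ (mult-map-*-prime p-prime x≢1 x≢p (pre k xs))
                                                                        (mult-pre-prime p-prime k xs) ⟩
  mult xs p * (mult xs 1 C k)                               ∎

choose-length< : ∀ k xs → length xs < k → choose k xs ≡ []
choose-length< (suc k) []       _             = refl
choose-length< (suc k) (x ∷ xs) (s≤s |xs|<k) rewrite choose-length< k xs |xs|<k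
                                                   | choose-length< (suc k) xs (m<n⇒m<1+n |xs|<k) = refl

aik≡sum-mult-pre : ∀ P q k n → aik P q k n ≡ sum (map (λ λs → mult (pre k λs) q) (P n))
aik≡sum-mult-pre P q k n = sum-map-filter (λ λs → k ≤? length λs) (λ λs → mult (pre k λs) q) short (P n)
  where
  short : ∀ λs → ¬ k ≤ length λs → mult (pre k λs) q ≡ 0
  short λs k≰|λs| rewrite choose-length< k λs (≰⇒> k≰|λs|) = refl

IsPartition-∷ʳ1 : ∀ {n μ} → IsPartition n μ → IsPartition (suc n) (μ ∷ʳ 1)
IsPartition-∷ʳ1 {n} {μ} (decreasing , positive , sum≡n) =
  Linked-∷ʳ decreasing positive , ++⁺ positive (s≤s z≤n ∷ []) ,
  trans (sum-++ μ [ 1 ]) (trans (cong (_+ 1) sum≡n) (+-comm n 1))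

IsPartition-∷ʳ1⁻ : ∀ {n} μ → IsPartition (suc n) (μ ∷ʳ 1) → IsPartition n μ
IsPartition-∷ʳ1⁻ {n} μ (decreasing , positive , sum≡1+n) =
  Linked-++⁻ˡ μ decreasing , ++⁻ˡ μ positive ,
  suc-injective (trans (+-comm 1 (sum μ)) (trans (sym (sum-++ μ [ 1 ])) sum≡1+n))

module PartitionSums (P : ℕ → List (List ℕ)) (P-unique : ∀ n → Unique (P n))
                     (P-spec : ∀ n λs → (λs ∈ P n) ⇔ IsPartition n λs) where

  onesChoose : (List ℕ → ℕ) → ℕ → ℕ → ℕ
  onesChoose w r n = sum (map (λ λs → w λs * (mult λs 1 C r)) (P n))

  withOne↭∷ʳ1 : ∀ n → filter (1 ∈?_) (P (suc n)) ↭ map (_∷ʳ 1) (P n)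
  withOne↭∷ʳ1 n = ∼bag⇒↭ (unique∧set⇒bag
    (Unique.filter⁺ (1 ∈?_) (P-unique (suc n)))
    (Unique.map⁺ (λ {μ} {ν} → ∷ʳ-injectiveˡ μ ν) (P-unique n))
    (mk⇔ to from))
    where
    to : ∀ {λs} → λs ∈ filter (1 ∈?_) (P (suc n)) → λs ∈ map (_∷ʳ 1) (P n)
    to {λs} λs∈ with ∈-filter⁻ (1 ∈?_) λs∈
    ... | λs∈P , 1∈λs with Equivalence.to (P-spec (suc n) λs) λs∈P
    ...   | isPartition@(decreasing , positive , _) with ∷ʳ-of-lowerBound-∈ decreasing positive 1∈λs
    ...     | μ , refl = ∈-map⁺ (_∷ʳ 1) (Equivalence.from (P-spec n μ) (IsPartition-∷ʳ1⁻ μ isPartition))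
    from : ∀ {λs} → λs ∈ map (_∷ʳ 1) (P n) → λs ∈ filter (1 ∈?_) (P (suc n))
    from λs∈ with ∈-map⁻ (_∷ʳ 1) λs∈
    ... | μ , μ∈P , refl =
      ∈-filter⁺ (1 ∈?_)
        (Equivalence.from (P-spec (suc n) (μ ∷ʳ 1)) (IsPartition-∷ʳ1 (Equivalence.to (P-spec n μ) μ∈P)))
        (∈-++⁺ʳ μ (here refl))

  onesChoose-pascal : ∀ {w} → (∀ μ → w (μ ∷ʳ 1) ≡ w μ) → ∀ r n →
                      onesChoose w (suc r) (suc n) ≡ onesChoose w (suc r) n + onesChoose w r n
  onesChoose-pascal {w} w-∷ʳ1 r n = begin
    sum (map g (P (suc n)))                   ≡⟨ sum-map-filter (1 ∈?_) g g≡0 (P (suc n)) ⟨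
    sum (map g (filter (1 ∈?_) (P (suc n))))  ≡⟨ sum-↭ (↭.map⁺ g (withOne↭∷ʳ1 n)) ⟩
    sum (map g (map (_∷ʳ 1) (P n)))           ≡⟨ cong sum (map-∘ (P n)) ⟨
    sum (map (g ∘ (_∷ʳ 1)) (P n))             ≡⟨ cong sum (map-cong g-∷ʳ1 (P n)) ⟩
    sum (map (λ μ → w μ * (mult μ 1 C suc r) + w μ * (mult μ 1 C r)) (P n))
                                              ≡⟨ sum-map-+ _ _ (P n) ⟩
    onesChoose w (suc r) n + onesChoose w r n ∎
    where
    g : List ℕ → ℕ
    g λs = w λs * (mult λs 1 C suc r)
    g≡0 : ∀ λs → 1 ∉ λs → g λs ≡ 0
    g≡0 λs 1∉λs rewrite mult-∉ 1∉λs = *-zeroʳ (w λs)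
    g-∷ʳ1 : ∀ μ → g (μ ∷ʳ 1) ≡ w μ * (mult μ 1 C suc r) + w μ * (mult μ 1 C r)
    g-∷ʳ1 μ = begin
      w (μ ∷ʳ 1) * (mult (μ ∷ʳ 1) 1 C suc r)
        ≡⟨ cong₂ (λ v a → v * (a C suc r)) (w-∷ʳ1 μ) (trans (mult-++ μ [ 1 ] 1) (+-comm (mult μ 1) 1)) ⟩
      w μ * (suc (mult μ 1) C suc r)
        ≡⟨ cong (w μ *_) (nCk+nC[k+1]≡[n+1]C[k+1] (mult μ 1) r) ⟨
      w μ * (mult μ 1 C r + mult μ 1 C suc r)
        ≡⟨ cong (w μ *_) (+-comm (mult μ 1 C r) (mult μ 1 C suc r)) ⟩
      w μ * (mult μ 1 C suc r + mult μ 1 C r)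
        ≡⟨ *-distribˡ-+ (w μ) (mult μ 1 C suc r) (mult μ 1 C r) ⟩
      w μ * (mult μ 1 C suc r) + w μ * (mult μ 1 C r) ∎

  Δ-onesChoose : ∀ {w} → (∀ μ → w (μ ∷ʳ 1) ≡ w μ) → ∀ r n →
                 Δ (λ m → + onesChoose w (suc r) m) n ≡ + onesChoose w r n
  Δ-onesChoose {w} w-∷ʳ1 r n = begin
    + onesChoose w (suc r) (suc n) ℤ.- + onesChoose w (suc r) n
      ≡⟨ cong (λ t → + t ℤ.- + onesChoose w (suc r) n) (onesChoose-pascal w-∷ʳ1 r n) ⟩
    + (onesChoose w (suc r) n + onesChoose w r n) ℤ.- + onesChoose w (suc r) n
      ≡⟨ cong (ℤ._- + onesChoose w (suc r) n) (pos-+ (onesChoose w (suc r) n) (onesChoose w r n)) ⟩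
    + onesChoose w (suc r) n ℤ.+ + onesChoose w r n ℤ.- + onesChoose w (suc r) n
      ≡⟨ xyx⁻¹≈y (+ onesChoose w (suc r) n) (+ onesChoose w r n) ⟩
    + onesChoose w r n ∎

  Δ^-onesChoose : ∀ {w} → (∀ μ → w (μ ∷ʳ 1) ≡ w μ) → ∀ j r n →
                  Δ^ j (λ m → + onesChoose w (r + j) m) n ≡ + onesChoose w r n
  Δ^-onesChoose {w} w-∷ʳ1 = Δ^-telescope (λ r m → + onesChoose w r m) (Δ-onesChoose w-∷ʳ1)

  aik-1≡onesChoose : ∀ k n → aik P 1 k n ≡ onesChoose (const 1) k n
  aik-1≡onesChoose k n = trans (aik≡sum-mult-pre P 1 k n)
    (cong sum (map-cong (λ λs → trans (mult-pre-1 k λs) (sym (*-identityˡ _))) (P n)))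

  aik-prime≡onesChoose : ∀ {p} → Prime p → ∀ k n → aik P p (suc k) n ≡ onesChoose (λ λs → mult λs p) k n
  aik-prime≡onesChoose p-prime k n = trans (aik≡sum-mult-pre P _ (suc k) n)
    (cong sum (map-cong (mult-pre-prime p-prime k) (P n)))

  onesChoose-1≡mTotal : ∀ n → onesChoose (const 1) 1 n ≡ mTotal P n 1
  onesChoose-1≡mTotal n = cong sum (map-cong (λ λs → trans (*-identityˡ _) (nC1≡n (mult λs 1))) (P n))

  onesChoose-0≡mTotal : ∀ p n → onesChoose (λ λs → mult λs p) 0 n ≡ mTotal P n p
  onesChoose-0≡mTotal p n = cong sum (map-cong (λ λs → *-identityʳ (mult λs p)) (P n))

theorem3p6 : (P : ℕ → List (List ℕ))
    → (∀ n → Unique (P n))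
    → (∀ n (λs : List ℕ) → (λs ∈ P n) ⇔ IsPartition n λs)
    → (k n p : ℕ) → 2 ≤ k → (p ≡ 1 ⊎ Prime p)
    → Δ^ (k ∸ 1) (λ m → + aik P p k m) n ≡ + mTotal P n p
theorem3p6 P P-unique P-spec (suc (suc j)) n p (s≤s (s≤s _)) (inj₁ refl) = begin
  Δ^ (suc j) (λ m → + aik P 1 (2 + j) m) n
    ≡⟨ Δ^-cong (suc j) (cong +_ ∘ aik-1≡onesChoose (2 + j)) n ⟩
  Δ^ (suc j) (λ m → + onesChoose (const 1) (1 + suc j) m) n
    ≡⟨ Δ^-onesChoose {const 1} (λ _ → refl) (suc j) 1 n ⟩
  + onesChoose (const 1) 1 n
    ≡⟨ cong +_ (onesChoose-1≡mTotal n) ⟩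
  + mTotal P n 1 ∎
  where open PartitionSums P P-unique P-spec
theorem3p6 P P-unique P-spec (suc (suc j)) n p (s≤s (s≤s _)) (inj₂ p-prime) = begin
  Δ^ (suc j) (λ m → + aik P p (2 + j) m) n
    ≡⟨ Δ^-cong (suc j) (cong +_ ∘ aik-prime≡onesChoose p-prime (suc j)) n ⟩
  Δ^ (suc j) (λ m → + onesChoose (λ λs → mult λs p) (0 + suc j) m) n
    ≡⟨ Δ^-onesChoose (λ μ → mult-∷ʳ-≢ μ 1≢p) (suc j) 0 n ⟩
  + onesChoose (λ λs → mult λs p) 0 n
    ≡⟨ cong +_ (onesChoose-0≡mTotal p n) ⟩
  + mTotal P n p ∎
  where
  open PartitionSums P P-unique P-spec
  1≢p : 1 ≢ p
  1≢p refl = ¬prime[1] p-prime
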